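{- Let $\epsilon\in(0,1)$, let $I^1$ be the rounded instance and let $\overline m\in\overline{\mathcal P}$ (see context). If there is a schedule $\sigma^2$ of $I^2(\overline m)$ such that $\sum_{j\in\sigma^2_i}p_{ij}\le(1+\epsilon)c_i$ for every machine $i$ of $I^2(\overline m)$, then there is a schedule $\sigma^3$ of the jobs of $I^1$ on its $m$ machines with $C^{I^1}_\Gamma(\sigma^3)\le(1+2\epsilon)^2$.
   Context: Robust scheduling on identical machines: $n$ jobs, $m$ identical machines, a positive integer $\Gamma$, each job $j$ has nominal processing time $\overline p_j\ge0$ and deviation $\hat p_j\ge0$. For a schedule $\sigma$ and machine $i$ with job set $\sigma_i$, $\Gamma(\sigma_i)$ denotes a set of $\Gamma$ jobs of $\sigma_i$ with largest deviation (ties arbitrary; all of $\sigma_i$ if $|\sigma_i|<\Gamma$), $C_\Gamma(\sigma)=\max_i\big(\sum_{j\in\sigma_i}\overline p_j+\sum_{j\in\Gamma(\sigma_i)}\hat p_j\big)$; $C^{I^1}_\Gamma$ denotes this cost computed with the deviations of $I^1$. Rounded instance $I^1$: same jobs, machines and nominal times; its deviations are $\hat p^1_j=0$ if $\hat p_j<\epsilon/\Gamma$, and otherwise the largest value of the form $\frac{\epsilon}{\Gamma}(1+\epsilon)^r$, $r\in\mathbb{Z}_{\ge0}$, not exceeding $\hat p_j$. Let $\Delta=\{0\}\cup\{\frac{\epsilon}{\Gamma}(1+\epsilon)^r: r\in\mathbb{Z}_{\ge0},\ \frac{\epsilon}{\Gamma}(1+\epsilon)^r\le\frac1\Gamma\}$.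 Let $\overline{\mathcal P}$ be the set of vectors $\overline m\in\{0,1,2,4,\dots,2^{\lfloor\log m\rfloor}\}^\Delta$ with $m/2\le\sum_l\overline m_l\le m$. For $\overline m\in\overline{\mathcal P}$ with $m'=\sum_l\overline m_l$, the instance $I^2(\overline m)$ (unrelated machines with capacities) is: for each $l\in\Delta$ a set $M_l$ of $\overline m_l$ original machines and a set $M'_l$ of $\overline m_l$ cloned machines, every machine $i\in M_l\cup M'_l$ having capacity $c_i=1-\Gamma l+\epsilon$; the regular jobs are the jobs of $I^1$ with $p_{ij}=\overline p_j+\hat p^1_j-l$ if $\hat p^1_j\ge l$ and $p_{ij}=\overline p_j$ otherwise, for $i\in M_l\cup M'_l$; in addition there are $2m'-m$ dummy jobs with $p_{ij}=\infty$ on original machines and $p_{ij}=c_i$ on cloned machines.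
   Formalization: The parameter ε, the nominal processing times $\overline p_j$ and the deviations $\hat p_j$ and $\hat p^1_j$ take rational values. -}

module Defs where

open import Data.Nat as ℕ using (ℕ; zero; suc; NonZero)
open import Data.Integer using (+_)
open import Data.Rational using (ℚ; 0ℚ; 1ℚ; _+_; _*_; _-_; _≤_; _<_; _/_)
open import Data.Rational.Properties using (_≤?_)
open import Data.Fin using (Fin; toℕ)
import Data.Fin
import Data.Fin.Subset
import Data.Empty
open import Data.Fin.Properties using (_≟_)
open import Data.Fin.Subset using (Subset)
open import Data.Vec using (lookup; tabulate)
open import Data.Bool using (Bool; true; false; if_then_else_)
open import Data.Sum using (_⊎_; inj₁; inj₂)
open import Data.Product using (Σ; _×_; _,_; ∃)
open import Data.Product.Properties as PP using ()
open import Data.Bool.Properties as BP using ()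
open import Relation.Nullary.Decidable using (⌊_⌋)
open import Relation.Binary.PropositionalEquality using (_≡_)
open import Relation.Binary.Definitions using (DecidableEquality)

_^ℚ_ : ℚ → ℕ → ℚ
x ^ℚ zero = 1ℚ
x ^ℚ suc k = x * (x ^ℚ k)

ℕtoℚ : ℕ → ℚ
ℕtoℚ k = (+ k) / 1

sumFin : (n : ℕ) → (Fin n → ℚ) → ℚ
sumFin zero f = 0ℚ
sumFin (suc n) f = f Data.Fin.zero + sumFin n (λ j → f (Data.Fin.suc j))

sumOver : {n : ℕ} → Subset n → (Fin n → ℚ) → ℚ
sumOver {n} S f = sumFin n (λ j → if lookup S j then f j else 0ℚ)

jobsOn : {n m : ℕ} → (Fin n → Fin m) → Fin m → Subset n
jobsOn σ i = tabulate (λ j → ⌊ σ j ≟ i ⌋)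

_⊆S_ : {n : ℕ} → Subset n → Subset n → Set
T ⊆S S = ∀ j → lookup T j ≡ true → lookup S j ≡ true

card : {n : ℕ} → Subset n → ℕ
card {n} S = Data.Fin.Subset.∣ S ∣

IsTopΓ : {n : ℕ} → ℕ → (Fin n → ℚ) → Subset n → Subset n → Set
IsTopΓ Γ d S T =
  T ⊆S S × card T ≡ ℕ._⊓_ Γ (card S) ×
  (∀ j j' → lookup T j ≡ true → lookup S j' ≡ true → lookup T j' ≡ false → d j' ≤ d j)

-- C_Γ(σ) ≤ B, with nominal times pb and deviations d: for every machine i
-- and every admissible choice of Γ(σ_i), the robust load of i is ≤ B.
-- (The robust load does not depend on how ties are broken.)
CostAtMost : {n m : ℕ} → ℕ → (Fin n → ℚ) → (Fin n → ℚ) → (Fin n → Fin m) → ℚ → Set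
CostAtMost Γ pb d σ B = ∀ i T → IsTopΓ Γ d (jobsOn σ i) T →
  sumOver (jobsOn σ i) pb + sumOver T d ≤ B

gridVal : (ε : ℚ) (Γ : ℕ) .{{_ : NonZero Γ}} → ℕ → ℚ
gridVal ε Γ r = (ε * (+ 1 / Γ)) * ((1ℚ + ε) ^ℚ r)

Rounded : (ε : ℚ) (Γ : ℕ) .{{_ : NonZero Γ}} → ℚ → ℚ → Set
Rounded ε Γ x y =
  (x < ε * (+ 1 / Γ) × y ≡ 0ℚ) ⊎
  (ε * (+ 1 / Γ) ≤ x × Σ ℕ (λ r → y ≡ gridVal ε Γ r × gridVal ε Γ r ≤ x
                                   × x < gridVal ε Γ (suc r)))

-- The set Δ: Δ = {0} ∪ {gridVal r : r < K}, where K is characterised by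
-- gridVal r ≤ 1/Γ ⇔ r < K (gridVal is strictly increasing).
-- Δ is indexed by Fin (suc K): zero ↦ 0, suc r ↦ gridVal r.

DeltaSize : (ε : ℚ) (Γ : ℕ) .{{_ : NonZero Γ}} → ℕ → Set
DeltaSize ε Γ K =
  (∀ r → r ℕ.< K → gridVal ε Γ r ≤ + 1 / Γ) × (+ 1 / Γ < gridVal ε Γ K)

deltaVal : (ε : ℚ) (Γ : ℕ) .{{_ : NonZero Γ}} {K : ℕ} → Fin (suc K) → ℚ
deltaVal ε Γ Data.Fin.zero = 0ℚ
deltaVal ε Γ (Data.Fin.suc r) = gridVal ε Γ (toℕ r)

PowOf2Upto : ℕ → ℕ → Set
PowOf2Upto m k = k ≡ 0 ⊎ Σ ℕ (λ e → k ≡ 2 ℕ.^ e × 2 ℕ.^ e ℕ.≤ m)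

sumℕ : (n : ℕ) → (Fin n → ℕ) → ℕ
sumℕ zero f = 0
sumℕ (suc n) f = f Data.Fin.zero ℕ.+ sumℕ n (λ j → f (Data.Fin.suc j))

InPbar : (m K : ℕ) → (Fin (suc K) → ℕ) → Set
InPbar m K mb = (∀ l → PowOf2Upto m (mb l)) ×
  m ℕ.≤ 2 ℕ.* sumℕ (suc K) mb × sumℕ (suc K) mb ℕ.≤ m

-- extended rationals (∞ for forbidden assignments)
data ℚ∞ : Set where
  fin : ℚ → ℚ∞
  ∞   : ℚ∞

_+∞_ : ℚ∞ → ℚ∞ → ℚ∞
fin x +∞ fin y = fin (x + y)
_ +∞ _ = ∞

_≤∞_ : ℚ∞ → ℚ → Set
fin x ≤∞ b = x ≤ b
∞ ≤∞ b = Data.Empty.⊥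

sumFin∞ : (n : ℕ) → (Fin n → ℚ∞) → ℚ∞
sumFin∞ zero f = fin 0ℚ
sumFin∞ (suc n) f = f Data.Fin.zero +∞ sumFin∞ n (λ j → f (Data.Fin.suc j))

-- machines of I²(m̄): (l , k , b), l ∈ Δ, k < m̄_l, b = true original / false clone
Mach2 : (K : ℕ) → (Fin (suc K) → ℕ) → Set
Mach2 K mb = Σ (Fin (suc K)) (λ l → Fin (mb l)) × Bool

mach2-≟ : {K : ℕ} {mb : Fin (suc K) → ℕ} → DecidableEquality (Mach2 K mb)
mach2-≟ = PP.≡-dec (PP.≡-dec _≟_ _≟_) BP._≟_

nDummy : (m K : ℕ) → (Fin (suc K) → ℕ) → ℕ
nDummy m K mb = 2 ℕ.* sumℕ (suc K) mb ℕ.∸ m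

Job2 : (n m K : ℕ) → (Fin (suc K) → ℕ) → Set
Job2 n m K mb = Fin n ⊎ Fin (nDummy m K mb)

cap : (ε : ℚ) (Γ : ℕ) .{{_ : NonZero Γ}} {K : ℕ} → Fin (suc K) → ℚ
cap ε Γ l = (1ℚ - ℕtoℚ Γ * deltaVal ε Γ l) + ε

p2 : (ε : ℚ) (Γ : ℕ) .{{_ : NonZero Γ}} {n m K : ℕ} {mb : Fin (suc K) → ℕ} →
     (pb ph1 : Fin n → ℚ) → Mach2 K mb → Job2 n m K mb → ℚ∞
p2 ε Γ pb ph1 ((l , _) , _) (inj₁ j) =
  if ⌊ deltaVal ε Γ l ≤? ph1 j ⌋ then fin (pb j + ph1 j - deltaVal ε Γ l) else fin (pb j)
p2 ε Γ pb ph1 ((l , _) , true) (inj₂ _) = ∞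
p2 ε Γ pb ph1 ((l , _) , false) (inj₂ _) = fin (cap ε Γ l)

load2 : (ε : ℚ) (Γ : ℕ) .{{_ : NonZero Γ}} {n m K : ℕ} {mb : Fin (suc K) → ℕ} →
        (pb ph1 : Fin n → ℚ) → (Job2 n m K mb → Mach2 K mb) → Mach2 K mb → ℚ∞
load2 ε Γ {n} {m} {K} {mb} pb ph1 σ i =
  sumFin∞ n (λ j → if ⌊ mach2-≟ {K} {mb} (σ (inj₁ j)) i ⌋ then p2 ε Γ {n} {m} {K} {mb} pb ph1 i (inj₁ j) else fin 0ℚ)
  +∞ sumFin∞ (nDummy m K mb)
       (λ j → if ⌊ mach2-≟ {K} {mb} (σ (inj₂ j)) i ⌋ then p2 ε Γ {n} {m} {K} {mb} pb ph1 i (inj₂ j) else fin 0ℚ)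

module Submission where

-- A dummy job on an original machine would cost ∞, so every dummy sits on a clone; a clone i
-- carrying a dummy has load at least cᵢ, hence carries exactly one dummy (two would cost
-- 2cᵢ > (1+ε)cᵢ) and regular load at most εcᵢ. Merge each such clone into its original, whose
-- regular load becomes at most (1+2ε)cᵢ. The 2m′−m dummies sit on distinct clones, so at most
-- m′ + (m′ − (2m′−m)) = m machines remain, and they are renumbered into the m machines of I¹.
-- On a machine of type l every job has p̄ⱼ + p̂¹ⱼ ≤ l + pᵢⱼ and p̄ⱼ ≤ pᵢⱼ, so the Γ largest
-- deviations add at most Γl to the I²-load, and Γl + (1+2ε)(1 − Γl + ε) ≤ (1+2ε)².

open import Defs
open import Data.Nat as ℕ using (ℕ; zero; suc; NonZero; z≤n; s≤s)
import Data.Nat.Properties as ℕ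
import Data.Nat.Coprimality as Coprime
import Data.Integer as ℤ
import Data.Integer.Properties as ℤ
open import Data.Rational using (ℚ; 0ℚ; 1ℚ; _+_; _*_; _-_; -_; _≤_; _<_; _/_; mkℚ; nonNegative; positive)
open import Data.Rational.Properties
open import Data.Rational.Solver using (module +-*-Solver)
open import Data.Fin as F using (Fin; toℕ; join; splitAt; inject≤)
import Data.Fin.Properties as F
open import Data.Fin.Subset using (Subset; _∈_; ∁; ∣_∣)
open import Data.Fin.Subset.Properties using (_∈?_; x∉p⇒x∈∁p; ∣∁p∣≡n∸∣p∣; ∣p∣≤n)
open import Data.Vec using ([]; _∷_; lookup; tabulate; here; there)
open import Data.Vec.Properties using (lookup∘tabulate; []=⇒lookup; lookup⇒[]=)
open import Data.Bool using (true; false; if_then_else_; not)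
open import Data.Bool.Properties using (if-float; T-≡)
open import Data.Product using (Σ; ∃; _×_; _,_; proj₁; proj₂)
open import Data.Sum using (_⊎_; inj₁; inj₂; [_,_]; map₂)
open import Data.Sum.Properties using (inj₁-injective; inj₂-injective)
open import Data.Empty using (⊥-elim)
open import Function using (_∘_; id; Injective)
open import Function.Bundles using (module Equivalence)
open import Relation.Binary.PropositionalEquality hiding ([_])
open import Relation.Nullary using (Dec; yes; no)
open import Relation.Nullary.Decidable using (⌊_⌋; toWitness; fromWitness)
open import Algebra.Properties.CommutativeSemigroup ℕ.+-commutativeSemigroup using (x∙yz≈y∙xz)

open +-*-Solver

≤-by-gap : ∀ {p q} g → 0ℚ ≤ g → p + g ≡ q → p ≤ q
≤-by-gap {p} g 0≤g refl = begin
  p      ≡⟨ sym (+-identityʳ p) ⟩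
  p + 0ℚ ≤⟨ +-monoʳ-≤ p 0≤g ⟩
  p + g  ∎
  where open ≤-Reasoning

+-cancelʳ-≤ : ∀ {p q} r → p + r ≤ q + r → p ≤ q
+-cancelʳ-≤ {p} {q} r p+r≤q+r = begin
  p           ≡⟨ solve 2 (λ p r → p := (p :+ r) :+ (:- r)) refl p r ⟩
  p + r + - r ≤⟨ +-monoˡ-≤ (- r) p+r≤q+r ⟩
  q + r + - r ≡⟨ solve 2 (λ q r → (q :+ r) :+ (:- r) := q) refl q r ⟩
  q           ∎
  where open ≤-Reasoning

p≤q⇒0≤q-p : ∀ {p q} → p ≤ q → 0ℚ ≤ q - p
p≤q⇒0≤q-p {p} {q} p≤q = begin
  0ℚ     ≡⟨ sym (+-inverseʳ p) ⟩
  p - p  ≤⟨ +-monoˡ-≤ (- p) p≤q ⟩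
  q - p  ∎
  where open ≤-Reasoning

+-nonNeg : ∀ {p q} → 0ℚ ≤ p → 0ℚ ≤ q → 0ℚ ≤ p + q
+-nonNeg {p} {q} 0≤p 0≤q =
  nonNegative⁻¹ _ {{nonNeg+nonNeg⇒nonNeg p {{nonNegative 0≤p}} q {{nonNegative 0≤q}}}}

*-nonNeg : ∀ {p q} → 0ℚ ≤ p → 0ℚ ≤ q → 0ℚ ≤ p * q
*-nonNeg {p} {q} 0≤p 0≤q =
  nonNegative⁻¹ _ {{nonNeg*nonNeg⇒nonNeg p {{nonNegative 0≤p}} q {{nonNegative 0≤q}}}}

^ℚ-nonNeg : ∀ {p} → 0ℚ ≤ p → ∀ k → 0ℚ ≤ p ^ℚ k
^ℚ-nonNeg 0≤p zero    = nonNegative⁻¹ 1ℚ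
^ℚ-nonNeg 0≤p (suc k) = *-nonNeg 0≤p (^ℚ-nonNeg 0≤p k)

ℕtoℚ-nonNeg : ∀ k → 0ℚ ≤ ℕtoℚ k
ℕtoℚ-nonNeg k = nonNegative⁻¹ _ {{normalize-nonNeg k 1}}

ℕtoℚ≡mkℚ : ∀ k → ℕtoℚ k ≡ mkℚ (ℤ.+ k) 0 (Coprime.sym (Coprime.1-coprimeTo k))
ℕtoℚ≡mkℚ k = normalize-coprime (Coprime.sym (Coprime.1-coprimeTo k))

ℕtoℚ-suc : ∀ k → ℕtoℚ (suc k) ≡ 1ℚ + ℕtoℚ k
ℕtoℚ-suc k = begin
  ℕtoℚ (suc k)                                 ≡⟨ /-cong {p₁ = ℤ.+ suc k} {q₁ = 1} (cong (λ z → ℤ.+ 1 ℤ.+ z) (sym (ℤ.*-identityʳ (ℤ.+ k)))) refl ⟩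
  (ℤ.+ 1 ℤ.* ℤ.+ 1 ℤ.+ ℤ.+ k ℤ.* ℤ.+ 1) / 1    ≡⟨ sym (cong₂ _+_ (ℕtoℚ≡mkℚ 1) (ℕtoℚ≡mkℚ k)) ⟩
  1ℚ + ℕtoℚ k                                  ∎
  where open ≡-Reasoning

ℕtoℚ-mono-≤ : ∀ {k l} → k ℕ.≤ l → ℕtoℚ k ≤ ℕtoℚ l
ℕtoℚ-mono-≤ {l = l} z≤n = ℕtoℚ-nonNeg l
ℕtoℚ-mono-≤ {suc k} {suc l} (s≤s k≤l) = begin
  ℕtoℚ (suc k)  ≡⟨ ℕtoℚ-suc k ⟩
  1ℚ + ℕtoℚ k   ≤⟨ +-monoʳ-≤ 1ℚ (ℕtoℚ-mono-≤ k≤l) ⟩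
  1ℚ + ℕtoℚ l   ≡⟨ sym (ℕtoℚ-suc l) ⟩
  ℕtoℚ (suc l)  ∎
  where open ≤-Reasoning

ℕtoℚ-*-inverse : ∀ Γ .{{_ : NonZero Γ}} → ℕtoℚ Γ * (ℤ.+ 1 / Γ) ≡ 1ℚ
ℕtoℚ-*-inverse (suc g)
  rewrite ℕtoℚ≡mkℚ (suc g) | normalize-coprime {1} {g} (Coprime.1-coprimeTo (suc g))
  = *-inverseʳ (mkℚ (ℤ.+ suc g) 0 (Coprime.sym (Coprime.1-coprimeTo (suc g))))

sumFin-cong : ∀ n {f g : Fin n → ℚ} → (∀ j → f j ≡ g j) → sumFin n f ≡ sumFin n g
sumFin-cong zero    f≗g = refl
sumFin-cong (suc n) f≗g = cong₂ _+_ (f≗g F.zero) (sumFin-cong n (f≗g ∘ F.suc))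

sumFin-mono : ∀ n {f g : Fin n → ℚ} → (∀ j → f j ≤ g j) → sumFin n f ≤ sumFin n g
sumFin-mono zero    f≤g = ≤-refl
sumFin-mono (suc n) f≤g = +-mono-≤ (f≤g F.zero) (sumFin-mono n (f≤g ∘ F.suc))

sumFin-+ : ∀ n (f g : Fin n → ℚ) → sumFin n (λ j → f j + g j) ≡ sumFin n f + sumFin n g
sumFin-+ zero    f g = sym (+-identityˡ 0ℚ)
sumFin-+ (suc n) f g = begin
  (f₀ + g₀) + sumFin n (λ j → f (F.suc j) + g (F.suc j))  ≡⟨ cong ((f₀ + g₀) +_) (sumFin-+ n (f ∘ F.suc) (g ∘ F.suc)) ⟩
  (f₀ + g₀) + (Σf + Σg)                                  ≡⟨ solve 4 (λ a b c d → (a :+ b) :+ (c :+ d) := (a :+ c) :+ (b :+ d)) refl f₀ g₀ Σf Σg ⟩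
  (f₀ + Σf) + (g₀ + Σg)                                  ∎
  where
  open ≡-Reasoning
  f₀ = f F.zero
  g₀ = g F.zero
  Σf = sumFin n (f ∘ F.suc)
  Σg = sumFin n (g ∘ F.suc)

sumFin-0 : ∀ n → sumFin n (λ _ → 0ℚ) ≡ 0ℚ
sumFin-0 zero    = refl
sumFin-0 (suc n) = trans (cong (0ℚ +_) (sumFin-0 n)) (+-identityˡ 0ℚ)

sumFin-nonNeg : ∀ n {f : Fin n → ℚ} → (∀ j → 0ℚ ≤ f j) → 0ℚ ≤ sumFin n f
sumFin-nonNeg n {f} 0≤f = subst (_≤ sumFin n f) (sumFin-0 n) (sumFin-mono n 0≤f)

term≤sumFin : ∀ n {f : Fin n → ℚ} → (∀ j → 0ℚ ≤ f j) → ∀ i → f i ≤ sumFin n f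
term≤sumFin (suc n) {f} 0≤f F.zero = ≤-by-gap (sumFin n (f ∘ F.suc)) (sumFin-nonNeg n (0≤f ∘ F.suc)) refl
term≤sumFin (suc n) {f} 0≤f (F.suc i) = begin
  f (F.suc i)                       ≡⟨ sym (+-identityˡ _) ⟩
  0ℚ + f (F.suc i)                  ≤⟨ +-mono-≤ (0≤f F.zero) (term≤sumFin n (0≤f ∘ F.suc) i) ⟩
  f F.zero + sumFin n (f ∘ F.suc)   ∎
  where open ≤-Reasoning

two-terms≤sumFin : ∀ n {f : Fin n → ℚ} → (∀ j → 0ℚ ≤ f j) →
                   ∀ {i i′} → i ≢ i′ → f i + f i′ ≤ sumFin n f
two-terms≤sumFin (suc n) 0≤f {F.zero} {F.zero} i≢i′ = ⊥-elim (i≢i′ refl)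
two-terms≤sumFin (suc n) {f} 0≤f {F.zero} {F.suc i′} _ =
  +-monoʳ-≤ (f F.zero) (term≤sumFin n (0≤f ∘ F.suc) i′)
two-terms≤sumFin (suc n) {f} 0≤f {F.suc i} {F.zero} _ =
  subst (_≤ _) (+-comm (f F.zero) (f (F.suc i))) (+-monoʳ-≤ (f F.zero) (term≤sumFin n (0≤f ∘ F.suc) i))
two-terms≤sumFin (suc n) {f} 0≤f {F.suc i} {F.suc i′} i≢i′ = begin
  f (F.suc i) + f (F.suc i′)        ≡⟨ sym (+-identityˡ _) ⟩
  0ℚ + (f (F.suc i) + f (F.suc i′)) ≤⟨ +-mono-≤ (0≤f F.zero) (two-terms≤sumFin n (0≤f ∘ F.suc) (i≢i′ ∘ cong F.suc)) ⟩
  f F.zero + sumFin n (f ∘ F.suc)   ∎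
  where open ≤-Reasoning

if-yes : ∀ {A X : Set} (a? : Dec A) → A → ∀ {x y : X} → (if ⌊ a? ⌋ then x else y) ≡ x
if-yes (yes _) _ = refl
if-yes (no ¬a) a = ⊥-elim (¬a a)

[_]·_ : ∀ {A : Set} → Dec A → ℚ → ℚ
[ a? ]· x = if ⌊ a? ⌋ then x else 0ℚ

indicator-nonNeg : ∀ {A : Set} (a? : Dec A) {x} → 0ℚ ≤ x → 0ℚ ≤ [ a? ]· x
indicator-nonNeg (yes _) 0≤x = 0≤x
indicator-nonNeg (no _)  _   = ≤-refl

indicator-mono : ∀ {A B : Set} → (A → B) → (a? : Dec A) (b? : Dec B) → ∀ {x} → 0ℚ ≤ x → [ a? ]· x ≤ [ b? ]· x
indicator-mono A⇒B (yes a) (yes _) 0≤x = ≤-refl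
indicator-mono A⇒B (yes a) (no ¬b) 0≤x = ⊥-elim (¬b (A⇒B a))
indicator-mono A⇒B (no _)  b?      0≤x = indicator-nonNeg b? 0≤x

indicator-split : ∀ {A B C : Set} → (A → B ⊎ C) → (a? : Dec A) (b? : Dec B) (c? : Dec C) → ∀ {x} → 0ℚ ≤ x →
                  [ a? ]· x ≤ [ b? ]· x + [ c? ]· x
indicator-split A⇒B⊎C (no _)  b?      c?      0≤x     = +-nonNeg (indicator-nonNeg b? 0≤x) (indicator-nonNeg c? 0≤x)
indicator-split A⇒B⊎C (yes a) (yes _) c?      0≤x     = ≤-by-gap _ (indicator-nonNeg c? 0≤x) refl
indicator-split A⇒B⊎C (yes a) (no _)  (yes _) {x} _   = ≤-reflexive (sym (+-identityˡ x))
indicator-split A⇒B⊎C (yes a) (no ¬b) (no ¬c) _       = ⊥-elim ([ ¬b , ¬c ] (A⇒B⊎C a))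

+∞-∞ : ∀ x → x +∞ ∞ ≡ ∞
+∞-∞ (fin _) = refl
+∞-∞ ∞       = refl

sumFin∞-fin : ∀ n {G : Fin n → ℚ∞} {f : Fin n → ℚ} → (∀ j → G j ≡ fin (f j)) → sumFin∞ n G ≡ fin (sumFin n f)
sumFin∞-fin zero    G≗f = refl
sumFin∞-fin (suc n) G≗f = cong₂ _+∞_ (G≗f F.zero) (sumFin∞-fin n (G≗f ∘ F.suc))

sumFin∞-∞ : ∀ n {G : Fin n → ℚ∞} i → G i ≡ ∞ → sumFin∞ n G ≡ ∞
sumFin∞-∞ (suc n) {G} F.zero    Gi≡∞ = cong (_+∞ sumFin∞ n (G ∘ F.suc)) Gi≡∞
sumFin∞-∞ (suc n) {G} (F.suc i) Gi≡∞ = trans (cong (G F.zero +∞_) (sumFin∞-∞ n i Gi≡∞)) (+∞-∞ (G F.zero))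

sumOver-jobsOn : ∀ {n m} (σ : Fin n → Fin m) i (f : Fin n → ℚ) →
                 sumOver (jobsOn σ i) f ≡ sumFin n (λ j → [ σ j F.≟ i ]· f j)
sumOver-jobsOn {n} σ i f = sumFin-cong n (λ j → cong (λ β → if β then f j else 0ℚ) (lookup∘tabulate _ j))

sumOver-const : ∀ {n} (T : Subset n) l → sumOver T (λ _ → l) ≡ ℕtoℚ (card T) * l
sumOver-const []          l = sym (*-zeroˡ l)
sumOver-const (false ∷ T) l = trans (+-identityˡ _) (sumOver-const T l)
sumOver-const (true ∷ T)  l = begin
  l + sumOver T (λ _ → l)     ≡⟨ cong (l +_) (sumOver-const T l) ⟩
  l + ℕtoℚ (card T) * l       ≡⟨ solve 2 (λ l k → l :+ k :* l := (con 1ℚ :+ k) :* l) refl l (ℕtoℚ (card T)) ⟩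
  (1ℚ + ℕtoℚ (card T)) * l    ≡⟨ cong (_* l) (sym (ℕtoℚ-suc (card T))) ⟩
  ℕtoℚ (suc (card T)) * l     ∎
  where open ≡-Reasoning

robust-load≤ : ∀ {n} (a h q : Fin n → ℚ) {l k} → 0ℚ ≤ l →
               (∀ j → a j + h j ≤ l + q j) → (∀ j → a j ≤ q j) →
               ∀ (S T : Subset n) → T ⊆S S → card T ℕ.≤ k →
               sumOver S a + sumOver T h ≤ ℕtoℚ k * l + sumOver S q
robust-load≤ {n} a h q {l} {k} 0≤l a+h≤l+q a≤q S T T⊆S ∣T∣≤k = begin
  sumOver S a + sumOver T h                       ≡⟨ sym (sumFin-+ n _ _) ⟩
  sumFin n (λ j → [ S ∋ j ] a j + [ T ∋ j ] h j)  ≤⟨ sumFin-mono n pointwise ⟩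
  sumFin n (λ j → [ T ∋ j ] l + [ S ∋ j ] q j)    ≡⟨ sumFin-+ n _ _ ⟩
  sumOver T (λ _ → l) + sumOver S q               ≡⟨ cong (_+ sumOver S q) (sumOver-const T l) ⟩
  ℕtoℚ (card T) * l + sumOver S q                 ≤⟨ +-monoˡ-≤ (sumOver S q) (*-monoʳ-≤-nonNeg l {{nonNegative 0≤l}} (ℕtoℚ-mono-≤ ∣T∣≤k)) ⟩
  ℕtoℚ k * l + sumOver S q                        ∎
  where
  open ≤-Reasoning
  [_∋_]_ : Subset n → Fin n → ℚ → ℚ
  [ U ∋ j ] x = if lookup U j then x else 0ℚ
  pointwise : ∀ j → [ S ∋ j ] a j + [ T ∋ j ] h j ≤ [ T ∋ j ] l + [ S ∋ j ] q j
  pointwise j with lookup S j | lookup T j | T⊆S j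
  ... | true  | true  | _   = a+h≤l+q j
  ... | true  | false | _   = subst₂ _≤_ (sym (+-identityʳ (a j))) (sym (+-identityˡ (q j))) (a≤q j)
  ... | false | false | _   = ≤-refl
  ... | false | true  | T⊆S with () ← T⊆S refl

rank : ∀ {n} {p : Subset n} {x} → x ∈ p → Fin ∣ p ∣
rank here                        = F.zero
rank {p = true ∷ p}  (there x∈p) = F.suc (rank x∈p)
rank {p = false ∷ p} (there x∈p) = rank x∈p

rank-injective : ∀ {n} {p : Subset n} {x y} (x∈p : x ∈ p) (y∈p : y ∈ p) → rank x∈p ≡ rank y∈p → x ≡ y
rank-injective here      here      _ = refl
rank-injective here      (there _) ()
rank-injective (there _) here      ()
rank-injective {p = true ∷ p}  (there x∈p) (there y∈p) eq = cong F.suc (rank-injective x∈p y∈p (F.suc-injective eq))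
rank-injective {p = false ∷ p} (there x∈p) (there y∈p) eq = cong F.suc (rank-injective x∈p y∈p eq)

injective⇒≤∣p∣ : ∀ {k n} {p : Subset n} {f : Fin k → Fin n} → Injective _≡_ _≡_ f → (∀ i → f i ∈ p) → k ℕ.≤ ∣ p ∣
injective⇒≤∣p∣ f-inj f∈p = F.injective⇒≤ (λ eq → f-inj (rank-injective (f∈p _) (f∈p _) eq))

∣p∣+∣∁p∣≡n : ∀ {n} (p : Subset n) → ∣ p ∣ ℕ.+ ∣ ∁ p ∣ ≡ n
∣p∣+∣∁p∣≡n p = trans (cong (∣ p ∣ ℕ.+_) (∣∁p∣≡n∸∣p∣ p)) (ℕ.m+[n∸m]≡n (∣p∣≤n p))

join-injective : ∀ m n {i j : Fin m ⊎ Fin n} → join m n i ≡ join m n j → i ≡ j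
join-injective m n {i} {j} eq = begin
  i                      ≡⟨ sym (F.splitAt-join m n i) ⟩
  splitAt m (join m n i) ≡⟨ cong (splitAt m) eq ⟩
  splitAt m (join m n j) ≡⟨ F.splitAt-join m n j ⟩
  j                      ∎
  where open ≡-Reasoning

encΣ : ∀ k (f : Fin k → ℕ) → Σ (Fin k) (Fin ∘ f) → Fin (sumℕ k f)
encΣ (suc k) f (F.zero  , i) = join (f F.zero) _ (inj₁ i)
encΣ (suc k) f (F.suc l , i) = join (f F.zero) _ (inj₂ (encΣ k (f ∘ F.suc) (l , i)))

encΣ-injective : ∀ k (f : Fin k → ℕ) → Injective _≡_ _≡_ (encΣ k f)
encΣ-injective (suc k) f {F.zero , i} {F.zero , i′} eq =
  cong (F.zero ,_) (inj₁-injective (join-injective (f F.zero) (sumℕ k (f ∘ F.suc)) eq))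
encΣ-injective (suc k) f {F.suc l , i} {F.suc l′ , i′} eq
  with encΣ-injective k (f ∘ F.suc) (inj₂-injective (join-injective (f F.zero) (sumℕ k (f ∘ F.suc)) eq))
... | refl = refl
encΣ-injective (suc k) f {F.zero , i} {F.suc l′ , i′} eq
  with () ← join-injective (f F.zero) _ {inj₁ i} {inj₂ (encΣ k (f ∘ F.suc) (l′ , i′))} eq
encΣ-injective (suc k) f {F.suc l , i} {F.zero , i′} eq
  with () ← join-injective (f F.zero) _ {inj₂ (encΣ k (f ∘ F.suc) (l , i))} {inj₁ i′} eq

d+m≡n+n⇒d+k≤n⇒n+k≤m : ∀ {d n m k} → d ℕ.+ m ≡ n ℕ.+ n → d ℕ.+ k ℕ.≤ n → n ℕ.+ k ℕ.≤ m
d+m≡n+n⇒d+k≤n⇒n+k≤m {d} {n} {m} {k} d+m≡n+n d+k≤n = ℕ.+-cancelˡ-≤ d _ _ (begin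
  d ℕ.+ (n ℕ.+ k)  ≡⟨ x∙yz≈y∙xz d n k ⟩
  n ℕ.+ (d ℕ.+ k)  ≤⟨ ℕ.+-monoʳ-≤ n d+k≤n ⟩
  n ℕ.+ n          ≡⟨ sym d+m≡n+n ⟩
  d ℕ.+ m          ∎)
  where open ℕ.≤-Reasoning

robust-budget : ∀ {ε x} → 0ℚ ≤ ε → 0ℚ ≤ x →
                x + (1ℚ + (ε + ε)) * ((1ℚ - x) + ε) ≤ (1ℚ + (ε + ε)) ^ℚ 2
robust-budget {ε} {x} 0≤ε 0≤x =
  ≤-by-gap (ε * (1ℚ + (ε + ε)) + (ε + ε) * x)
    (+-nonNeg (*-nonNeg 0≤ε (+-nonNeg (nonNegative⁻¹ 1ℚ) (+-nonNeg 0≤ε 0≤ε))) (*-nonNeg (+-nonNeg 0≤ε 0≤ε) 0≤x))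
    (solve 2 (λ ε x → x :+ (con 1ℚ :+ (ε :+ ε)) :* ((con 1ℚ :- x) :+ ε) :+ (ε :* (con 1ℚ :+ (ε :+ ε)) :+ (ε :+ ε) :* x)
                     := (con 1ℚ :+ (ε :+ ε)) :* ((con 1ℚ :+ (ε :+ ε)) :* con 1ℚ)) refl ε x)

gridVal-nonNeg : ∀ {ε} → 0ℚ ≤ ε → ∀ Γ .{{_ : NonZero Γ}} r → 0ℚ ≤ gridVal ε Γ r
gridVal-nonNeg 0≤ε Γ r =
  *-nonNeg (*-nonNeg 0≤ε (nonNegative⁻¹ _ {{normalize-nonNeg 1 Γ}})) (^ℚ-nonNeg (+-nonNeg (nonNegative⁻¹ 1ℚ) 0≤ε) r)

deltaVal-nonNeg : ∀ {ε} → 0ℚ ≤ ε → ∀ Γ .{{_ : NonZero Γ}} {K} (l : Fin (suc K)) → 0ℚ ≤ deltaVal ε Γ l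
deltaVal-nonNeg 0≤ε Γ F.zero    = ≤-refl
deltaVal-nonNeg 0≤ε Γ (F.suc r) = gridVal-nonNeg 0≤ε Γ (toℕ r)

Γ*deltaVal≤1 : ∀ {ε Γ K} .{{_ : NonZero Γ}} → DeltaSize ε Γ K → (l : Fin (suc K)) → ℕtoℚ Γ * deltaVal ε Γ l ≤ 1ℚ
Γ*deltaVal≤1 {Γ = Γ} _ F.zero = subst (_≤ 1ℚ) (sym (*-zeroʳ (ℕtoℚ Γ))) (nonNegative⁻¹ 1ℚ)
Γ*deltaVal≤1 {ε} {Γ} (grid≤1/Γ , _) (F.suc r) = begin
  ℕtoℚ Γ * gridVal ε Γ (toℕ r)  ≤⟨ *-monoˡ-≤-nonNeg (ℕtoℚ Γ) {{nonNegative (ℕtoℚ-nonNeg Γ)}} (grid≤1/Γ (toℕ r) (F.toℕ<n r)) ⟩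
  ℕtoℚ Γ * (ℤ.+ 1 / Γ)          ≡⟨ ℕtoℚ-*-inverse Γ ⟩
  1ℚ                            ∎
  where open ≤-Reasoning

cap-pos : ∀ {ε Γ K} .{{_ : NonZero Γ}} → 0ℚ < ε → DeltaSize ε Γ K → (l : Fin (suc K)) → 0ℚ < cap ε Γ l
cap-pos {ε} {Γ} 0<ε Δ l = begin-strict
  0ℚ                                  ≡⟨ sym (+-identityʳ 0ℚ) ⟩
  0ℚ + 0ℚ                             <⟨ +-mono-≤-< (p≤q⇒0≤q-p (Γ*deltaVal≤1 Δ l)) 0<ε ⟩
  (1ℚ - ℕtoℚ Γ * deltaVal ε Γ l) + ε  ∎
  where open ≤-Reasoning

module FromCapacitatedSchedule
  (ε : ℚ) (0<ε : 0ℚ < ε) (ε<1 : ε < 1ℚ)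
  (n m Γ : ℕ) .{{_ : NonZero Γ}}
  (pb ph1 : Fin n → ℚ) (pb≥0 : ∀ j → 0ℚ ≤ pb j)
  (K : ℕ) (Δ : DeltaSize ε Γ K)
  (mb : Fin (suc K) → ℕ) (m̄∈𝒫̄ : InPbar m K mb)
  (σ2 : Job2 n m K mb → Mach2 K mb)
  (fits : ∀ i → load2 ε Γ {n} {m} {K} {mb} pb ph1 σ2 i ≤∞ ((1ℚ + ε) * cap ε Γ (proj₁ (proj₁ i))))
  where

  Mach : Set
  Mach = Mach2 K mb

  _≟ₘ_ : (i i′ : Mach) → Dec (i ≡ i′)
  _≟ₘ_ = mach2-≟ {K} {mb}

  D : ℕ
  D = nDummy m K mb

  type : Mach → Fin (suc K)
  type i = proj₁ (proj₁ i)

  δ c mergedCap : Fin (suc K) → ℚ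
  δ = deltaVal ε Γ
  c = cap ε Γ
  mergedCap l = (1ℚ + (ε + ε)) * c l

  0≤ε : 0ℚ ≤ ε
  0≤ε = <⇒≤ 0<ε

  0≤c : ∀ l → 0ℚ ≤ c l
  0≤c l = <⇒≤ (cap-pos 0<ε Δ l)

  [1+ε]c≡εc+c : ∀ l → (1ℚ + ε) * c l ≡ ε * c l + c l
  [1+ε]c≡εc+c l = solve 2 (λ ε c → (con 1ℚ :+ ε) :* c := ε :* c :+ c) refl ε (c l)

  [1+ε]c+εc≡mergedCap : ∀ l → (1ℚ + ε) * c l + ε * c l ≡ mergedCap l
  [1+ε]c+εc≡mergedCap l = solve 2 (λ ε c → (con 1ℚ :+ ε) :* c :+ ε :* c := (con 1ℚ :+ (ε :+ ε)) :* c) refl ε (c l)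

  regularTime : Fin (suc K) → Fin n → ℚ
  regularTime l j = if ⌊ δ l ≤? ph1 j ⌋ then pb j + ph1 j - δ l else pb j

  pb≤regularTime : ∀ l j → pb j ≤ regularTime l j
  pb≤regularTime l j with δ l ≤? ph1 j
  ... | yes δ≤ph1 = ≤-by-gap (ph1 j - δ l) (p≤q⇒0≤q-p δ≤ph1)
                      (solve 3 (λ p h d → p :+ (h :- d) := p :+ h :- d) refl (pb j) (ph1 j) (δ l))
  ... | no  _     = ≤-refl

  pb+ph1≤δ+regularTime : ∀ l j → pb j + ph1 j ≤ δ l + regularTime l j
  pb+ph1≤δ+regularTime l j with δ l ≤? ph1 j
  ... | yes _     = ≤-reflexive (solve 3 (λ p h d → p :+ h := d :+ (p :+ h :- d)) refl (pb j) (ph1 j) (δ l))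
  ... | no  δ≰ph1 = subst (_ ≤_) (+-comm (pb j) (δ l)) (+-monoʳ-≤ (pb j) (<⇒≤ (≰⇒> δ≰ph1)))

  0≤regularTime : ∀ l j → 0ℚ ≤ regularTime l j
  0≤regularTime l j = ≤-trans (pb≥0 j) (pb≤regularTime l j)

  machineOf : Fin n → Mach
  machineOf j = σ2 (inj₁ j)

  host : Fin D → Mach
  host d = σ2 (inj₂ d)

  regularLoad : Mach → ℚ
  regularLoad i = sumFin n (λ j → [ machineOf j ≟ₘ i ]· regularTime (type i) j)

  dummyLoad : Mach → ℚ
  dummyLoad i = sumFin D (λ d → [ host d ≟ₘ i ]· c (type i))

  0≤regularLoad : ∀ i → 0ℚ ≤ regularLoad i
  0≤regularLoad i = sumFin-nonNeg n (λ j → indicator-nonNeg (machineOf j ≟ₘ i) (0≤regularTime (type i) j))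

  0≤dummyLoad : ∀ i → 0ℚ ≤ dummyLoad i
  0≤dummyLoad i = sumFin-nonNeg D (λ d → indicator-nonNeg (host d ≟ₘ i) (0≤c (type i)))

  regularTerm : Mach → Fin n → ℚ∞
  regularTerm i j = if ⌊ machineOf j ≟ₘ i ⌋ then p2 ε Γ {n} {m} {K} {mb} pb ph1 i (inj₁ j) else fin 0ℚ

  dummyTerm : Mach → Fin D → ℚ∞
  dummyTerm i d = if ⌊ host d ≟ₘ i ⌋ then p2 ε Γ {n} {m} {K} {mb} pb ph1 i (inj₂ d) else fin 0ℚ

  dummies-on-clones : ∀ d → proj₂ (host d) ≡ false
  dummies-on-clones d with host d in host-d≡
  ... | a , false = refl
  ... | a , true  = ⊥-elim (subst (_≤∞ _) load≡∞ (fits (a , true)))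
    where
    load≡∞ : load2 ε Γ {n} {m} {K} {mb} pb ph1 σ2 (a , true) ≡ ∞
    load≡∞ = trans (cong (sumFin∞ n (regularTerm (a , true)) +∞_) (sumFin∞-∞ D d (if-yes (host d ≟ₘ (a , true)) host-d≡)))
                   (+∞-∞ (sumFin∞ n (regularTerm (a , true))))

  regularTerm-fin : ∀ i j → regularTerm i j ≡ fin ([ machineOf j ≟ₘ i ]· regularTime (type i) j)
  regularTerm-fin i j = begin
    regularTerm i j                                                              ≡⟨ cong (λ v → if ⌊ machineOf j ≟ₘ i ⌋ then v else fin 0ℚ)
                                                                                      (sym (if-float fin ⌊ δ (type i) ≤? ph1 j ⌋)) ⟩
    (if ⌊ machineOf j ≟ₘ i ⌋ then fin (regularTime (type i) j) else fin 0ℚ)   ≡⟨ sym (if-float fin ⌊ machineOf j ≟ₘ i ⌋) ⟩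
    fin ([ machineOf j ≟ₘ i ]· regularTime (type i) j)                          ∎
    where open ≡-Reasoning

  dummyTerm-fin : ∀ i d → dummyTerm i d ≡ fin ([ host d ≟ₘ i ]· c (type i))
  dummyTerm-fin (a , false) d = sym (if-float fin ⌊ host d ≟ₘ (a , false) ⌋)
  dummyTerm-fin (a , true)  d with host d ≟ₘ (a , true)
  ... | no  _       = refl
  ... | yes host-d≡ with () ← trans (sym (cong proj₂ host-d≡)) (dummies-on-clones d)

  load-bound : ∀ i → regularLoad i + dummyLoad i ≤ (1ℚ + ε) * c (type i)
  load-bound i = subst (_≤∞ _) load≡ (fits i)
    where
    load≡ : load2 ε Γ {n} {m} {K} {mb} pb ph1 σ2 i ≡ fin (regularLoad i + dummyLoad i)
    load≡ = cong₂ _+∞_ (sumFin∞-fin n (regularTerm-fin i)) (sumFin∞-fin D (dummyTerm-fin i))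

  regularLoad≤ : ∀ i → regularLoad i ≤ (1ℚ + ε) * c (type i)
  regularLoad≤ i = ≤-trans (≤-by-gap (dummyLoad i) (0≤dummyLoad i) refl) (load-bound i)

  regularLoad≤mergedCap : ∀ i → regularLoad i ≤ mergedCap (type i)
  regularLoad≤mergedCap i =
    ≤-trans (regularLoad≤ i) (≤-by-gap (ε * c (type i)) (*-nonNeg 0≤ε (0≤c (type i))) ([1+ε]c+εc≡mergedCap (type i)))

  c≤dummyLoad-of-host : ∀ d → c (type (host d)) ≤ dummyLoad (host d)
  c≤dummyLoad-of-host d = subst (_≤ dummyLoad i) (if-yes (host d ≟ₘ i) refl)
    (term≤sumFin D (λ d′ → indicator-nonNeg (host d′ ≟ₘ i) (0≤c (type i))) d)
    where i = host d

  regularLoad-of-host≤ : ∀ d → regularLoad (host d) ≤ ε * c (type (host d))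
  regularLoad-of-host≤ d = +-cancelʳ-≤ (c (type i)) (begin
    regularLoad i + c (type i)     ≤⟨ +-monoʳ-≤ (regularLoad i) (c≤dummyLoad-of-host d) ⟩
    regularLoad i + dummyLoad i    ≤⟨ load-bound i ⟩
    (1ℚ + ε) * c (type i)          ≡⟨ [1+ε]c≡εc+c (type i) ⟩
    ε * c (type i) + c (type i)    ∎)
    where
    open ≤-Reasoning
    i = host d

  host-injective : Injective _≡_ _≡_ host
  host-injective {d} {d′} host-d≡host-d′ with d F.≟ d′
  ... | yes d≡d′ = d≡d′
  ... | no  d≢d′ = ⊥-elim (<-irrefl refl (≤-<-trans cᵢ≤ε*cᵢ ε*cᵢ<cᵢ))
    where
    open ≤-Reasoning
    i = host d
    cᵢ = c (type i)
    cᵢ+cᵢ≤dummyLoad : cᵢ + cᵢ ≤ dummyLoad i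
    cᵢ+cᵢ≤dummyLoad = subst₂ (λ x y → x + y ≤ dummyLoad i) (if-yes (host d ≟ₘ i) refl) (if-yes (host d′ ≟ₘ i) (sym host-d≡host-d′))
      (two-terms≤sumFin D (λ d″ → indicator-nonNeg (host d″ ≟ₘ i) (0≤c (type i))) d≢d′)
    cᵢ≤ε*cᵢ : cᵢ ≤ ε * cᵢ
    cᵢ≤ε*cᵢ = +-cancelʳ-≤ cᵢ (begin
      cᵢ + cᵢ                      ≡⟨ sym (+-identityˡ _) ⟩
      0ℚ + (cᵢ + cᵢ)               ≤⟨ +-mono-≤ (0≤regularLoad i) cᵢ+cᵢ≤dummyLoad ⟩
      regularLoad i + dummyLoad i  ≤⟨ load-bound i ⟩
      (1ℚ + ε) * cᵢ                ≡⟨ [1+ε]c≡εc+c (type i) ⟩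
      ε * cᵢ + cᵢ                  ∎)
    ε*cᵢ<cᵢ : ε * cᵢ < cᵢ
    ε*cᵢ<cᵢ = subst (ε * cᵢ <_) (*-identityˡ cᵢ) (*-monoˡ-<-pos cᵢ {{positive (cap-pos 0<ε Δ (type i))}} ε<1)

  N : ℕ
  N = sumℕ (suc K) mb

  Position : Set
  Position = Σ (Fin (suc K)) (Fin ∘ mb)

  enc : Position → Fin N
  enc = encΣ (suc K) mb

  site : Fin D → Position
  site d = proj₁ (host d)

  host≡clone : ∀ d → host d ≡ (site d , false)
  host≡clone d = cong (site d ,_) (dummies-on-clones d)

  site-injective : Injective _≡_ _≡_ site
  site-injective {d} {d′} eq = host-injective (trans (host≡clone d) (trans (cong (_, false) eq) (sym (host≡clone d′))))

  hosts : Subset N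
  hosts = tabulate (λ x → ⌊ F.any? (λ d → enc (site d) F.≟ x) ⌋)

  ∈hosts⇒site : ∀ {a} → enc a ∈ hosts → ∃ λ d → site d ≡ a
  ∈hosts⇒site {a} a∈hosts
    with d , eq ← toWitness (Equivalence.from T-≡ (trans (sym (lookup∘tabulate _ (enc a))) ([]=⇒lookup a∈hosts)))
    = d , encΣ-injective (suc K) mb eq

  site∈hosts : ∀ d → enc (site d) ∈ hosts
  site∈hosts d = lookup⇒[]= (enc (site d)) hosts
    (trans (lookup∘tabulate _ (enc (site d))) (Equivalence.to T-≡ (fromWitness (d , refl))))

  N+∣∁hosts∣≤m : N ℕ.+ ∣ ∁ hosts ∣ ℕ.≤ m
  N+∣∁hosts∣≤m = d+m≡n+n⇒d+k≤n⇒n+k≤m D+m≡N+N D+∣∁hosts∣≤N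
    where
    D+m≡N+N : D ℕ.+ m ≡ N ℕ.+ N
    D+m≡N+N = trans (ℕ.m∸n+n≡m (proj₁ (proj₂ m̄∈𝒫̄))) (cong (N ℕ.+_) (ℕ.+-identityʳ N))
    D+∣∁hosts∣≤N : D ℕ.+ ∣ ∁ hosts ∣ ℕ.≤ N
    D+∣∁hosts∣≤N = subst (D ℕ.+ ∣ ∁ hosts ∣ ℕ.≤_) (∣p∣+∣∁p∣≡n hosts)
      (ℕ.+-monoˡ-≤ ∣ ∁ hosts ∣ (injective⇒≤∣p∣ (site-injective ∘ encΣ-injective (suc K) mb) site∈hosts))

  Slot : Set
  Slot = Fin N ⊎ Fin ∣ ∁ hosts ∣

  cloneSlot : ∀ a → Dec (enc a ∈ hosts) → Slot
  cloneSlot a (yes _)      = inj₁ (enc a)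
  cloneSlot a (no a∉hosts) = inj₂ (rank (x∉p⇒x∈∁p a∉hosts))

  slot : Mach → Slot
  slot (a , true)  = inj₁ (enc a)
  slot (a , false) = cloneSlot a (enc a ∈? hosts)

  relabel : Mach → Fin m
  relabel i = inject≤ (join N ∣ ∁ hosts ∣ (slot i)) N+∣∁hosts∣≤m

  relabel-≡ : ∀ i′ i → relabel i′ ≡ relabel i → slot i′ ≡ slot i
  relabel-≡ i′ i eq = join-injective N ∣ ∁ hosts ∣ (F.inject≤-injective _ _ _ _ eq)

  twin : Mach → Mach
  twin (a , b) = a , not b

  inj₁-enc-injective : ∀ {a′ a} → _≡_ {A = Slot} (inj₁ (enc a′)) (inj₁ (enc a)) → a′ ≡ a
  inj₁-enc-injective eq = encΣ-injective (suc K) mb (inj₁-injective eq)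

  slot-≡ : ∀ i′ i → slot i′ ≡ slot i → i′ ≡ i ⊎ (i′ ≡ twin i × enc (proj₁ i) ∈ hosts)
  slot-≡ (a′ , true) (a , true) eq = inj₁ (cong (_, true) (inj₁-enc-injective eq))
  slot-≡ (a′ , true) (a , false) eq with enc a ∈? hosts
  ... | yes a∈hosts = inj₂ (cong (_, true) (inj₁-enc-injective eq) , a∈hosts)
  slot-≡ (a′ , false) (a , true) eq with enc a′ ∈? hosts
  ... | yes a′∈hosts with refl ← inj₁-enc-injective {a′} {a} eq = inj₂ (refl , a′∈hosts)
  slot-≡ (a′ , false) (a , false) eq with enc a′ ∈? hosts | enc a ∈? hosts
  ... | yes _       | yes _      = inj₁ (cong (_, false) (inj₁-enc-injective eq))
  ... | no a′∉hosts | no a∉hosts =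
    inj₁ (cong (_, false) (encΣ-injective (suc K) mb
      (rank-injective (x∉p⇒x∈∁p a′∉hosts) (x∉p⇒x∈∁p a∉hosts) (inj₂-injective eq))))

  original+clone≤mergedCap : ∀ a → enc a ∈ hosts → regularLoad (a , true) + regularLoad (a , false) ≤ mergedCap (proj₁ a)
  original+clone≤mergedCap a a∈hosts with d , refl ← ∈hosts⇒site {a} a∈hosts = begin
    regularLoad (a , true) + regularLoad (a , false)  ≤⟨ +-mono-≤ (regularLoad≤ (a , true)) clone≤ ⟩
    (1ℚ + ε) * c l + ε * c l                          ≡⟨ [1+ε]c+εc≡mergedCap l ⟩
    mergedCap l                                       ∎
    where
    open ≤-Reasoning
    l = proj₁ a
    clone≤ : regularLoad (a , false) ≤ ε * c l
    clone≤ = subst (λ i → regularLoad i ≤ ε * c (type i)) (host≡clone d) (regularLoad-of-host≤ d)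

  twin-loads≤mergedCap : ∀ i → enc (proj₁ i) ∈ hosts → regularLoad i + regularLoad (twin i) ≤ mergedCap (type i)
  twin-loads≤mergedCap (a , true)  a∈hosts = original+clone≤mergedCap a a∈hosts
  twin-loads≤mergedCap (a , false) a∈hosts = subst (_≤ mergedCap (proj₁ a))
    (+-comm (regularLoad (a , true)) (regularLoad (a , false))) (original+clone≤mergedCap a a∈hosts)

  σ3 : Fin n → Fin m
  σ3 j = relabel (machineOf j)

  load-on-relabel≤ : ∀ i → sumFin n (λ j → [ σ3 j F.≟ relabel i ]· regularTime (type i) j) ≤ mergedCap (type i)
  load-on-relabel≤ i with enc (proj₁ i) ∈? hosts
  ... | yes i∈hosts = begin
    sumFin n (λ j → [ σ3 j F.≟ relabel i ]· t j)                                   ≤⟨ sumFin-mono n (λ j →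
      indicator-split (same-or-twin j) (σ3 j F.≟ relabel i) (machineOf j ≟ₘ i) (machineOf j ≟ₘ twin i) (0≤regularTime (type i) j)) ⟩
    sumFin n (λ j → [ machineOf j ≟ₘ i ]· t j + [ machineOf j ≟ₘ twin i ]· t j)    ≡⟨ sumFin-+ n _ _ ⟩
    regularLoad i + regularLoad (twin i)                                           ≤⟨ twin-loads≤mergedCap i i∈hosts ⟩
    mergedCap (type i)                                                             ∎
    where
    open ≤-Reasoning
    t = regularTime (type i)
    same-or-twin : ∀ j → σ3 j ≡ relabel i → machineOf j ≡ i ⊎ machineOf j ≡ twin i
    same-or-twin j = map₂ proj₁ ∘ slot-≡ (machineOf j) i ∘ relabel-≡ (machineOf j) i
  ... | no i∉hosts = begin
    sumFin n (λ j → [ σ3 j F.≟ relabel i ]· regularTime (type i) j)  ≤⟨ sumFin-mono n (λ j →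
      indicator-mono (same j) (σ3 j F.≟ relabel i) (machineOf j ≟ₘ i) (0≤regularTime (type i) j)) ⟩
    regularLoad i                                                    ≤⟨ regularLoad≤mergedCap i ⟩
    mergedCap (type i)                                               ∎
    where
    open ≤-Reasoning
    same : ∀ j → σ3 j ≡ relabel i → machineOf j ≡ i
    same j eq = [ id , ⊥-elim ∘ i∉hosts ∘ proj₂ ] (slot-≡ (machineOf j) i (relabel-≡ (machineOf j) i eq))

  load-on≤ : ∀ t → ∃ λ l → sumFin n (λ j → [ σ3 j F.≟ t ]· regularTime l j) ≤ mergedCap l
  load-on≤ t with F.any? (λ j → σ3 j F.≟ t)
  ... | yes (j₀ , refl) = type (machineOf j₀) , load-on-relabel≤ (machineOf j₀)
  ... | no  idle        = F.zero , (begin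
    sumFin n (λ j → [ σ3 j F.≟ t ]· regularTime F.zero j)  ≤⟨ sumFin-mono n (λ j →
      indicator-mono (λ eq → idle (j , eq)) (σ3 j F.≟ t) (no λ ()) (0≤regularTime F.zero j)) ⟩
    sumFin n (λ _ → 0ℚ)                                    ≡⟨ sumFin-0 n ⟩
    0ℚ                                                     ≤⟨ *-nonNeg (+-nonNeg (nonNegative⁻¹ 1ℚ) (+-nonNeg 0≤ε 0≤ε)) (0≤c F.zero) ⟩
    mergedCap F.zero                                       ∎)
    where open ≤-Reasoning

  σ3-cost≤ : CostAtMost Γ pb ph1 σ3 ((1ℚ + (ε + ε)) ^ℚ 2)
  σ3-cost≤ t T (T⊆S , ∣T∣≡Γ⊓∣S∣ , _) with l , load≤ ← load-on≤ t = begin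
    sumOver S pb + sumOver T ph1                                 ≤⟨ robust-load≤ pb ph1 (regularTime l) (deltaVal-nonNeg 0≤ε Γ l)
                                                                      (pb+ph1≤δ+regularTime l) (pb≤regularTime l) S T T⊆S ∣T∣≤Γ ⟩
    ℕtoℚ Γ * δ l + sumOver S (regularTime l)                     ≡⟨ cong (ℕtoℚ Γ * δ l +_) (sumOver-jobsOn σ3 t (regularTime l)) ⟩
    ℕtoℚ Γ * δ l + sumFin n (λ j → [ σ3 j F.≟ t ]· regularTime l j)  ≤⟨ +-monoʳ-≤ (ℕtoℚ Γ * δ l) load≤ ⟩
    ℕtoℚ Γ * δ l + mergedCap l                                   ≤⟨ robust-budget 0≤ε (*-nonNeg (ℕtoℚ-nonNeg Γ) (deltaVal-nonNeg 0≤ε Γ l)) ⟩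
    (1ℚ + (ε + ε)) ^ℚ 2                                          ∎
    where
    open ≤-Reasoning
    S = jobsOn σ3 t
    ∣T∣≤Γ : card T ℕ.≤ Γ
    ∣T∣≤Γ = subst (ℕ._≤ Γ) (sym ∣T∣≡Γ⊓∣S∣) (ℕ.m⊓n≤m Γ (card S))

lemma7 : (ε : ℚ) → 0ℚ < ε → ε < 1ℚ →
    (n m Γ : ℕ) .{{_ : NonZero Γ}} →
    (pb ph ph1 : Fin n → ℚ) →
    (∀ j → 0ℚ ≤ pb j) → (∀ j → 0ℚ ≤ ph j) →
    (∀ j → Rounded ε Γ (ph j) (ph1 j)) →
    (K : ℕ) → DeltaSize ε Γ K →
    (mb : Fin (suc K) → ℕ) → InPbar m K mb →
    (σ2 : Job2 n m K mb → Mach2 K mb) →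
    (∀ i → load2 ε Γ {n} {m} {K} {mb} pb ph1 σ2 i ≤∞ ((1ℚ + ε) * cap ε Γ (proj₁ (proj₁ i)))) →
    Σ (Fin n → Fin m) (λ σ3 →
      CostAtMost Γ pb ph1 σ3 ((1ℚ + (ε + ε)) ^ℚ 2))
lemma7 ε 0<ε ε<1 n m Γ pb _ ph1 pb≥0 _ _ K Δ mb m̄∈𝒫̄ σ2 fits = σ3 , σ3-cost≤
  where open FromCapacitatedSchedule ε 0<ε ε<1 n m Γ pb ph1 pb≥0 K Δ mb m̄∈𝒫̄ σ2 fits
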